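{- Let $\mathbf u\in\{0,1\}^{\mathbb N}$ be such that $\mathbf v=S(\mathbf u)$ is uniformly recurrent. If the set of factors of $\mathbf v$ contains infinitely many $R$-palindromes centered at the letter $1$ and infinitely many $R$-palindromes not centered at the letter $1$, then the language of $\mathbf u$ is closed under all elements of $H=\{\mathrm{id},R,E,RE\}$.
   Context: $R$ is reversal; $E$ the antimorphism $E(w_0\cdots w_n)=\overline{w_n}\cdots\overline{w_0}$ with $\overline0=1,\overline1=0$. An $R$-palindrome $w$ (i.e. $R(w)=w$) is centered at $x\in\{0,1,\varepsilon\}$ if $w=yxR(y)$ for some word $y$. $S(u_0u_1\cdots)=v_1v_2\cdots$ with $v_i=(u_{i-1}+u_i)\bmod2$. A language is closed under $\mu$ if it contains $\mu(w)$ for each of its words $w$. Uniformly recurrent: every factor occurs infinitely often with bounded gaps. -}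

module Defs where

open import Data.Bool using (Bool; true; false; not; _xor_)
open import Data.Nat using (ℕ; zero; suc; _+_; _≤_)
open import Data.List using (List; []; _∷_; _++_; [_]; length; reverse; map)
open import Data.Product using (∃; ∃-syntax; _×_; _,_)
open import Data.Sum using (_⊎_)
open import Relation.Binary.PropositionalEquality using (_≡_)

-- Letters: false = 0, true = 1.  Infinite words indexed from 0.
InfWord : Set
InfWord = ℕ → Bool

factorAt : InfWord → ℕ → ℕ → List Bool
factorAt u i zero    = []
factorAt u i (suc n) = u i ∷ factorAt u (suc i) n

OccursAt : List Bool → InfWord → ℕ → Set
OccursAt w u i = factorAt u i (length w) ≡ w

IsFactor : List Bool → InfWord → Set
IsFactor w u = ∃[ i ] OccursAt w u i

UniformlyRecurrent : InfWord → Set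
UniformlyRecurrent u =
  ∀ w → IsFactor w u → ∃[ L ] (∀ i → ∃[ j ] (i ≤ j × j ≤ i + L × OccursAt w u j))

-- S(u_0 u_1 ...) = v_1 v_2 ... with v_i = u_{i-1} + u_i mod 2 (indexed from 0 here)
S : InfWord → InfWord
S u n = u n xor u (suc n)

R : List Bool → List Bool
R w = reverse w

E : List Bool → List Bool
E w = reverse (map not w)

RE : List Bool → List Bool
RE w = R (E w)

IsRPalindrome : List Bool → Set
IsRPalindrome w = R w ≡ w

CenteredAtLetter : Bool → List Bool → Set
CenteredAtLetter x w = ∃[ y ] (w ≡ y ++ [ x ] ++ R y)

CenteredAtEmpty : List Bool → Set
CenteredAtEmpty w = ∃[ y ] (w ≡ y ++ R y)

-- infinitely many factors of v satisfying P (unbounded lengths; equivalent to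
-- infinitely many distinct such words over a finite alphabet)
InfinitelyManyFactors : (List Bool → Set) → InfWord → Set
InfinitelyManyFactors P v = ∀ n → ∃[ w ] (n ≤ length w × IsFactor w v × P w)

ClosedUnder : (List Bool → List Bool) → InfWord → Set
ClosedUnder μ u = ∀ w → IsFactor w u → IsFactor (μ w) u

-- Write v = S u.  Two nonempty words of equal length have the same image under S iff they are
-- equal or complementary, so a palindromic factor p of v lifts to a factor W of u with
-- R W = W or R W = complement of W, i.e. W = E W; the latter happens exactly when p is
-- centred at 1.  By uniform recurrence every factor of v lies inside palindromes of both
-- kinds.  Hence a factor w of u occurs, up to complement, inside a factor W = E W, and W in
-- turn inside an R-palindromic factor W′; an occurrence of W in W′ and its mirror image are
-- W and its complement in some order, so the complement of W, hence of w, is a factor.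
-- With closure under complement, the mirror image of w inside an R-palindromic factor gives
-- closure under R, and then under E and RE = complement.
module Submission where

open import Defs
open import Data.Bool using (Bool; true; false; not; _xor_)
open import Data.Bool.Properties using (xor-assoc; xor-comm; xor-same; xor-identityʳ; not-¬)
open import Data.Nat using (zero; suc; _+_; _∸_; ⌊_/2⌋; ⌈_/2⌉)
open import Data.Nat.Properties
  using (+-suc; +-identityʳ; +-assoc; suc-injective; m≤n⇒∃[o]m+o≡n; +-cancelˡ-≤; ≤-trans; +-monoˡ-≤;
         m≤n⇒m⊓n≡m; m+n∸m≡n; ⌊n/2⌋≤n; ⌊n/2⌋+⌈n/2⌉≡n)
open import Data.List using (List; []; _∷_; _++_; [_]; _∷ʳ_; length; reverse; map; take; drop)
open import Data.List.Properties
  using (∷-injectiveˡ; ∷-injectiveʳ; ++-assoc; map-++; map-id; map-∘; map-cong; length-map;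
         length-reverse; reverse-++; reverse-map; reverse-involutive; unfold-reverse;
         take++drop≡id; length-take; length-drop)
open import Data.Product using (∃; ∃-syntax; _×_; _,_; proj₁; proj₂; uncurry)
open import Data.Sum using (_⊎_; inj₁; inj₂)
open import Data.Empty using (⊥-elim)
open import Relation.Nullary using (¬_)
open import Relation.Binary.PropositionalEquality
  using (_≡_; refl; sym; trans; cong; cong₂; subst; module ≡-Reasoning)
open import Function using (id)
open ≡-Reasoning

xor-cancelˡ : ∀ a b → a xor (a xor b) ≡ b
xor-cancelˡ a b = trans (sym (xor-assoc a a b)) (cong (_xor b) (xor-same a))

xor-cancelʳ : ∀ a b → (a xor b) xor b ≡ a
xor-cancelʳ a b = trans (xor-assoc a b b) (trans (cong (a xor_) (xor-same b)) (xor-identityʳ a))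

++-injective : ∀ {A : Set} (xs ys : List A) {zs ws} →
  length xs ≡ length ys → xs ++ zs ≡ ys ++ ws → xs ≡ ys × zs ≡ ws
++-injective []       []       _   eq = refl , eq
++-injective (x ∷ xs) (y ∷ ys) len eq
  with ++-injective xs ys (suc-injective len) (∷-injectiveʳ eq)
... | xs≡ys , zs≡ws = cong₂ _∷_ (∷-injectiveˡ eq) xs≡ys , zs≡ws

halves : ∀ {A : Set} (p : List A) →
  ∃[ y ] ∃[ z ] (p ≡ y ++ z × (length z ≡ length y ⊎ length z ≡ suc (length y)))
halves p = take h p , drop h p , sym (take++drop≡id h p) , lengths
  where
  n = length p
  h = ⌊ n /2⌋

  ⌈n/2⌉≡⌊n/2⌋⊎ : ∀ m → ⌈ m /2⌉ ≡ ⌊ m /2⌋ ⊎ ⌈ m /2⌉ ≡ suc ⌊ m /2⌋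
  ⌈n/2⌉≡⌊n/2⌋⊎ zero          = inj₁ refl
  ⌈n/2⌉≡⌊n/2⌋⊎ (suc zero)    = inj₂ refl
  ⌈n/2⌉≡⌊n/2⌋⊎ (suc (suc m)) with ⌈n/2⌉≡⌊n/2⌋⊎ m
  ... | inj₁ e = inj₁ (cong suc e)
  ... | inj₂ e = inj₂ (cong suc e)

  length-take-h : length (take h p) ≡ h
  length-take-h = trans (length-take h p) (m≤n⇒m⊓n≡m (⌊n/2⌋≤n n))

  length-drop-h : length (drop h p) ≡ ⌈ n /2⌉
  length-drop-h = trans (length-drop h p)
    (trans (cong (_∸ h) (sym (⌊n/2⌋+⌈n/2⌉≡n n))) (m+n∸m≡n h ⌈ n /2⌉))

  lengths : length (drop h p) ≡ length (take h p) ⊎ length (drop h p) ≡ suc (length (take h p))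
  lengths rewrite length-take-h | length-drop-h = ⌈n/2⌉≡⌊n/2⌋⊎ n

palindrome-centred : ∀ p → IsRPalindrome p → CenteredAtEmpty p ⊎ ∃[ x ] CenteredAtLetter x p
palindrome-centred p pal with halves p
... | y , z , refl , inj₁ even = inj₁ (y , cong (y ++_) z≡Ry)
  where
  Rz≡y : reverse z ≡ y
  Rz≡y = proj₁ (++-injective (reverse z) y (trans (length-reverse z) even)
           (trans (sym (reverse-++ y z)) pal))
  z≡Ry : z ≡ reverse y
  z≡Ry = trans (sym (reverse-involutive z)) (cong reverse Rz≡y)
... | y , x ∷ z , refl , inj₂ odd = inj₂ (x , y , cong (λ t → y ++ x ∷ t) z≡Ry)
  where
  Rz≡y : reverse z ≡ y
  Rz≡y = proj₁ (++-injective (reverse z) y (trans (length-reverse z) (suc-injective odd))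
    (begin
      reverse z ++ x ∷ reverse y   ≡⟨ ++-assoc (reverse z) [ x ] (reverse y) ⟨
      (reverse z ∷ʳ x) ++ reverse y ≡⟨ cong (_++ reverse y) (sym (unfold-reverse x z)) ⟩
      reverse (x ∷ z) ++ reverse y ≡⟨ reverse-++ y (x ∷ z) ⟨
      reverse (y ++ x ∷ z)         ≡⟨ pal ⟩
      y ++ x ∷ z                   ∎))
  z≡Ry : z ≡ reverse y
  z≡Ry = trans (sym (reverse-involutive z)) (cong reverse Rz≡y)

infixr 6 _⊕_

_⊕_ : Bool → List Bool → List Bool
d ⊕ w = map (d xor_) w

⊕-false : ∀ w → false ⊕ w ≡ w
⊕-false = map-id

⊕-⊕ : ∀ c d w → c ⊕ d ⊕ w ≡ (c xor d) ⊕ w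
⊕-⊕ c d w = trans (sym (map-∘ w)) (map-cong (λ a → sym (xor-assoc c d a)) w)

⊕-comm : ∀ c d w → c ⊕ d ⊕ w ≡ d ⊕ c ⊕ w
⊕-comm c d w = trans (⊕-⊕ c d w) (trans (cong (_⊕ w) (xor-comm c d)) (sym (⊕-⊕ d c w)))

⊕-involutive : ∀ c w → c ⊕ c ⊕ w ≡ w
⊕-involutive c w = trans (⊕-⊕ c c w) (trans (cong (_⊕ w) (xor-same c)) (⊕-false w))

complement-from-shifts : ∀ (P : List Bool → Set) d w → P (d ⊕ w) → P (true ⊕ d ⊕ w) → P (true ⊕ w)
complement-from-shifts P false w _ q = subst (λ x → P (true ⊕ x)) (⊕-false w) q
complement-from-shifts P true  w p _ = p

Δ : List Bool → List Bool
Δ []          = []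
Δ (a ∷ [])    = []
Δ (a ∷ b ∷ w) = (a xor b) ∷ Δ (b ∷ w)

length-Δ : ∀ a w → length (Δ (a ∷ w)) ≡ length w
length-Δ a []      = refl
length-Δ b (a ∷ w) = cong suc (length-Δ a w)

Δ-++ : ∀ xs a ys → Δ (xs ++ a ∷ ys) ≡ Δ (xs ∷ʳ a) ++ Δ (a ∷ ys)
Δ-++ []            a ys = refl
Δ-++ (x ∷ [])      a ys = refl
Δ-++ (x ∷ x′ ∷ xs) a ys = cong ((x xor x′) ∷_) (Δ-++ (x′ ∷ xs) a ys)

Δ-reverse : ∀ w → Δ (reverse w) ≡ reverse (Δ w)
Δ-reverse []          = refl
Δ-reverse (a ∷ [])    = refl
Δ-reverse (a ∷ b ∷ w) = begin
  Δ (reverse (a ∷ b ∷ w))              ≡⟨ cong Δ (unfold-reverse a (b ∷ w)) ⟩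
  Δ (reverse (b ∷ w) ∷ʳ a)             ≡⟨ cong (λ x → Δ (x ∷ʳ a)) (unfold-reverse b w) ⟩
  Δ ((reverse w ∷ʳ b) ∷ʳ a)            ≡⟨ cong Δ (++-assoc (reverse w) [ b ] [ a ]) ⟩
  Δ (reverse w ++ b ∷ [ a ])           ≡⟨ Δ-++ (reverse w) b [ a ] ⟩
  Δ (reverse w ∷ʳ b) ++ [ b xor a ]    ≡⟨ cong₂ (λ x c → Δ x ++ [ c ]) (sym (unfold-reverse b w)) (xor-comm b a) ⟩
  Δ (reverse (b ∷ w)) ++ [ a xor b ]   ≡⟨ cong (_++ [ a xor b ]) (Δ-reverse (b ∷ w)) ⟩
  reverse (Δ (b ∷ w)) ∷ʳ (a xor b)     ≡⟨ unfold-reverse (a xor b) (Δ (b ∷ w)) ⟨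
  reverse (Δ (a ∷ b ∷ w))              ∎

integrate : Bool → List Bool → List Bool
integrate a []       = [ a ]
integrate a (x ∷ xs) = a ∷ integrate (a xor x) xs

integrate-Δ : ∀ a w → integrate a (Δ (a ∷ w)) ≡ a ∷ w
integrate-Δ a []      = refl
integrate-Δ a (b ∷ w) =
  cong (a ∷_) (trans (cong (λ c → integrate c (Δ (b ∷ w))) (xor-cancelˡ a b)) (integrate-Δ b w))

integrate-⊕ : ∀ d a xs → integrate (d xor a) xs ≡ d ⊕ integrate a xs
integrate-⊕ d a []       = refl
integrate-⊕ d a (x ∷ xs) =
  cong ((d xor a) ∷_) (trans (cong (λ c → integrate c xs) (xor-assoc d a x)) (integrate-⊕ d (a xor x) xs))

Δ-injective : ∀ a x b y → Δ (a ∷ x) ≡ Δ (b ∷ y) → b ∷ y ≡ (b xor a) ⊕ (a ∷ x)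
Δ-injective a x b y eq = begin
  b ∷ y                                    ≡⟨ integrate-Δ b y ⟨
  integrate b (Δ (b ∷ y))                  ≡⟨ cong₂ integrate (sym (xor-cancelʳ b a)) (sym eq) ⟩
  integrate ((b xor a) xor a) (Δ (a ∷ x))  ≡⟨ integrate-⊕ (b xor a) a (Δ (a ∷ x)) ⟩
  (b xor a) ⊕ integrate a (Δ (a ∷ x))      ≡⟨ cong ((b xor a) ⊕_) (integrate-Δ a x) ⟩
  (b xor a) ⊕ (a ∷ x)                      ∎

-- Symmetric false W says W is an R-palindrome, Symmetric true W that W = E W.
Symmetric : Bool → List Bool → Set
Symmetric c W = reverse W ≡ c ⊕ W

symmetric-Δ : ∀ a w → IsRPalindrome (Δ (a ∷ w)) → ∃[ c ] Symmetric c (a ∷ w)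
symmetric-Δ a w pal with reverse (a ∷ w) in eq | Δ-reverse (a ∷ w)
... | []    | _    = ⊥-elim (0≢suc (trans (sym (cong length eq)) (length-reverse (a ∷ w))))
  where
  0≢suc : ∀ {n} → ¬ 0 ≡ suc n
  0≢suc ()
... | b ∷ y | Δrev = b xor a , Δ-injective a w b y (trans (sym pal) (sym Δrev))

symmetric-middle : ∀ {c} W A M V → Symmetric c W → W ≡ A ++ M ++ V → length A ≡ length V →
  Symmetric c M
symmetric-middle {c} W A M V sym-W refl len = proj₁ (++-injective (reverse M) (c ⊕ M)
  (trans (length-reverse M) (sym (length-map (c xor_) M)))
  (proj₂ (++-injective (reverse V) (c ⊕ A)
    (trans (length-reverse V) (trans (sym len) (sym (length-map (c xor_) A))))
    (begin
      reverse V ++ reverse M ++ reverse A    ≡⟨ ++-assoc (reverse V) (reverse M) (reverse A) ⟨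
      (reverse V ++ reverse M) ++ reverse A  ≡⟨ cong (_++ reverse A) (reverse-++ M V) ⟨
      reverse (M ++ V) ++ reverse A          ≡⟨ reverse-++ A (M ++ V) ⟨
      reverse (A ++ M ++ V)                  ≡⟨ sym-W ⟩
      c ⊕ (A ++ M ++ V)                      ≡⟨ map-++ (c xor_) A (M ++ V) ⟩
      c ⊕ A ++ c ⊕ (M ++ V)                  ≡⟨ cong (c ⊕ A ++_) (map-++ (c xor_) M V) ⟩
      c ⊕ A ++ c ⊕ M ++ c ⊕ V                ∎))))

Δ-split : ∀ a w ys {zs} → Δ (a ∷ w) ≡ ys ++ zs →
  ∃[ A ] ∃[ b ] ∃[ V ] (a ∷ w ≡ A ++ b ∷ V × length A ≡ length ys × Δ (b ∷ V) ≡ zs)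
Δ-split a w        []       eq = [] , a , w , refl , refl , eq
Δ-split a (a′ ∷ w) (y ∷ ys) eq with Δ-split a′ w ys (∷-injectiveʳ eq)
... | A , b , V , w≡ , len , ΔV = a ∷ A , b , V , cong (a ∷_) w≡ , cong suc len , ΔV

Δ-prefix : ∀ a w xs {zs} → Δ (a ∷ w) ≡ xs ++ zs → ∃[ V ] ∃[ B ] (w ≡ V ++ B × Δ (a ∷ V) ≡ xs)
Δ-prefix a w        []       eq = [] , w , refl , refl
Δ-prefix a (a′ ∷ w) (x ∷ xs) eq with Δ-prefix a′ w xs (∷-injectiveʳ eq)
... | V , B , w≡ , ΔV = a′ ∷ V , B , cong (a′ ∷_) w≡ , cong₂ _∷_ (∷-injectiveˡ eq) ΔV

symmetric-centredAt : ∀ {c x} a w → Symmetric c (a ∷ w) → CenteredAtLetter x (Δ (a ∷ w)) → c ≡ x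
symmetric-centredAt {c} {x} a w sym-W (y , Δ≡) with Δ-split a w y Δ≡
... | _ , _ , []     , _ , _ , ()
... | A , b , b′ ∷ V , W≡ , len , ΔV = begin
  c               ≡⟨ xor-cancelʳ c b ⟨
  (c xor b) xor b ≡⟨ xor-comm (c xor b) b ⟩
  b xor (c xor b) ≡⟨ cong (b xor_) (sym b′≡) ⟩
  b xor b′        ≡⟨ ∷-injectiveˡ ΔV ⟩
  x               ∎
  where
  length-V : length A ≡ length V
  length-V = trans len (trans (sym (length-reverse y))
               (trans (cong length (sym (∷-injectiveʳ ΔV))) (length-Δ b′ V)))
  b′≡ : b′ ≡ c xor b
  b′≡ = ∷-injectiveˡ (symmetric-middle {c} (a ∷ w) A (b ∷ [ b′ ]) V sym-W W≡ length-V)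

symmetric-centredAtEmpty : ∀ {c} a w → Symmetric c (a ∷ w) → CenteredAtEmpty (Δ (a ∷ w)) → c ≡ false
symmetric-centredAtEmpty {c} a w sym-W (y , Δ≡) with Δ-split a w y Δ≡
... | A , b , V , W≡ , len , ΔV = fixed c (∷-injectiveˡ b≡)
  where
  length-V : length A ≡ length V
  length-V = trans len (trans (sym (length-reverse y)) (trans (cong length (sym ΔV)) (length-Δ b V)))
  b≡ : [ b ] ≡ [ c xor b ]
  b≡ = symmetric-middle {c} (a ∷ w) A [ b ] V sym-W W≡ length-V
  fixed : ∀ c → b ≡ c xor b → c ≡ false
  fixed false _ = refl
  fixed true  e = ⊥-elim (not-¬ refl e)

lift-centredAt1 : ∀ a w → IsRPalindrome (Δ (a ∷ w)) → CenteredAtLetter true (Δ (a ∷ w)) →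
  Symmetric true (a ∷ w)
lift-centredAt1 a w pal centred with symmetric-Δ a w pal
... | c , sym-W = subst (λ c → Symmetric c (a ∷ w)) (symmetric-centredAt {c} a w sym-W centred) sym-W

lift-notCentredAt1 : ∀ a w → IsRPalindrome (Δ (a ∷ w)) → ¬ CenteredAtLetter true (Δ (a ∷ w)) →
  Symmetric false (a ∷ w)
lift-notCentredAt1 a w pal ¬centred with symmetric-Δ a w pal
... | c , sym-W = subst (λ c → Symmetric c (a ∷ w)) c≡false sym-W
  where
  c≡false : c ≡ false
  c≡false with palindrome-centred (Δ (a ∷ w)) pal
  ... | inj₁ centred           = symmetric-centredAtEmpty {c} a w sym-W centred
  ... | inj₂ (false , centred) = symmetric-centredAt {c} a w sym-W centred
  ... | inj₂ (true  , centred) = ⊥-elim (¬centred centred)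

Infix : List Bool → List Bool → Set
Infix v w = ∃[ xs ] ∃[ ys ] w ≡ xs ++ v ++ ys

infix-map : ∀ f {v w} → Infix v w → Infix (map f v) (map f w)
infix-map f {v} (xs , ys , refl) = map f xs , map f ys ,
  trans (map-++ f xs (v ++ ys)) (cong (map f xs ++_) (map-++ f v ys))

infix-reverse : ∀ {v w} → Infix v w → Infix (reverse v) (reverse w)
infix-reverse {v} (xs , ys , refl) = reverse ys , reverse xs , (begin
  reverse (xs ++ v ++ ys)                 ≡⟨ reverse-++ xs (v ++ ys) ⟩
  reverse (v ++ ys) ++ reverse xs         ≡⟨ cong (_++ reverse xs) (reverse-++ v ys) ⟩
  (reverse ys ++ reverse v) ++ reverse xs ≡⟨ ++-assoc (reverse ys) (reverse v) (reverse xs) ⟩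
  reverse ys ++ reverse v ++ reverse xs   ∎)

length-factorAt : ∀ u i n → length (factorAt u i n) ≡ n
length-factorAt u i zero    = refl
length-factorAt u i (suc n) = cong suc (length-factorAt u (suc i) n)

factorAt-+ : ∀ u i m n → factorAt u i (m + n) ≡ factorAt u i m ++ factorAt u (i + m) n
factorAt-+ u i zero    n = cong (λ j → factorAt u j n) (sym (+-identityʳ i))
factorAt-+ u i (suc m) n = cong (u i ∷_)
  (trans (factorAt-+ u (suc i) m n) (cong (λ j → factorAt u (suc i) m ++ factorAt u j n) (sym (+-suc i m))))

factorAt-S : ∀ u i m → factorAt (S u) i m ≡ Δ (factorAt u i (suc m))
factorAt-S u i zero    = refl
factorAt-S u i (suc m) = cong (S u i ∷_) (factorAt-S u (suc i) m)

occursAt-++ˡ : ∀ {u} xs {ys} i → OccursAt (xs ++ ys) u i → OccursAt xs u i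
occursAt-++ˡ []       i _   = refl
occursAt-++ˡ (x ∷ xs) i occ = cong₂ _∷_ (∷-injectiveˡ occ) (occursAt-++ˡ xs (suc i) (∷-injectiveʳ occ))

isFactor-++ʳ : ∀ {u} xs {ys} → IsFactor (xs ++ ys) u → IsFactor ys u
isFactor-++ʳ []       fac     = fac
isFactor-++ʳ (x ∷ xs) (i , occ) = isFactor-++ʳ xs (suc i , ∷-injectiveʳ occ)

isFactor-infix : ∀ {u v w} → IsFactor w u → Infix v w → IsFactor v u
isFactor-infix {v = v} fac (xs , ys , refl) with isFactor-++ʳ xs fac
... | i , occ = i , occursAt-++ˡ v i occ

isFactor-Δ : ∀ {u} a w → IsFactor (a ∷ w) u → IsFactor (Δ (a ∷ w)) (S u)
isFactor-Δ {u} a w (i , occ) = i , (begin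
  factorAt (S u) i (length (Δ (a ∷ w)))  ≡⟨ cong (factorAt (S u) i) (length-Δ a w) ⟩
  factorAt (S u) i (length w)            ≡⟨ factorAt-S u i (length w) ⟩
  Δ (factorAt u i (suc (length w)))      ≡⟨ cong Δ occ ⟩
  Δ (a ∷ w)                              ∎)

isFactor-S-lift : ∀ {u x} → IsFactor x (S u) → ∃[ a ] ∃[ w ] (IsFactor (a ∷ w) u × Δ (a ∷ w) ≡ x)
isFactor-S-lift {u} {x} (i , occ) = u i , factorAt u (suc i) (length x) ,
  (i , cong (λ n → factorAt u i (suc n)) (length-factorAt u (suc i) (length x))) ,
  trans (sym (factorAt-S u i (length x))) occ

uniformlyRecurrent-embed : ∀ {P : List Bool → Set} {v x} → UniformlyRecurrent v →
  InfinitelyManyFactors P v → IsFactor x v → ∃[ p ] (P p × IsFactor p v × Infix x p)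
uniformlyRecurrent-embed {v = v} {x} ur im fac with ur x fac
... | L , gaps with im (L + length x)
... | p , long , (j , occ-p) , Pp with gaps j
... | k , j≤k , k≤j+L , occ-x with m≤n⇒∃[o]m+o≡n j≤k
... | a , refl with m≤n⇒∃[o]m+o≡n (≤-trans (+-monoˡ-≤ (length x) (+-cancelˡ-≤ j a L k≤j+L)) long)
... | r , length-p = p , Pp , (j , occ-p) , factorAt v j a , rest , (begin
  p                                                     ≡⟨ occ-p ⟨
  factorAt v j (length p)                               ≡⟨ cong (factorAt v j) length-p ⟨
  factorAt v j (a + length x + r)                       ≡⟨ cong (factorAt v j) (+-assoc a (length x) r) ⟩
  factorAt v j (a + (length x + r))                     ≡⟨ factorAt-+ v j a (length x + r) ⟩
  factorAt v j a ++ factorAt v (j + a) (length x + r)   ≡⟨ cong (factorAt v j a ++_) (factorAt-+ v (j + a) (length x) r) ⟩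
  factorAt v j a ++ factorAt v (j + a) (length x) ++ rest ≡⟨ cong (λ y → factorAt v j a ++ y ++ rest) occ-x ⟩
  factorAt v j a ++ x ++ rest                           ∎)
  where
  rest = factorAt v (j + a + length x) r

Δ-infix : ∀ b W ys x zs → Δ (b ∷ W) ≡ ys ++ x ++ zs →
  ∃[ c ] ∃[ V ] (Infix (c ∷ V) (b ∷ W) × Δ (c ∷ V) ≡ x)
Δ-infix b W ys x zs eq with Δ-split b W ys eq
... | A , c , V₀ , W≡ , _ , ΔV₀ with Δ-prefix c V₀ x ΔV₀
... | V , B , V₀≡ , ΔV = c , V , (A , B , trans W≡ (cong (λ t → A ++ c ∷ t) V₀≡)) , ΔV

symmetric-infix : ∀ {u c V W} → IsFactor W u → Symmetric c W → Infix V W → IsFactor (c ⊕ reverse V) u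
symmetric-infix {c = c} {W = W} fac sym-W inf =
  isFactor-infix fac (subst (Infix _) (trans (cong (c ⊕_) sym-W) (⊕-involutive c W))
                                      (infix-map (c xor_) (infix-reverse inf)))

LiftsSymmetric : (List Bool → Set) → Bool → Set
LiftsSymmetric P c = ∀ a w → P (Δ (a ∷ w)) → Symmetric c (a ∷ w)

-- Opaque because unfolding the witnesses of this existential during with-abstraction makes
-- type checking blow up.
opaque
  symmetricCover : ∀ {u P c} → UniformlyRecurrent (S u) → InfinitelyManyFactors P (S u) →
    LiftsSymmetric P c → ∀ a w → IsFactor (a ∷ w) u →
    ∃[ b ] ∃[ W ] ∃[ d ] (IsFactor (b ∷ W) u × Symmetric c (b ∷ W) × Infix (d ⊕ (a ∷ w)) (b ∷ W))
  symmetricCover {P = P} ur im lifts a w fac with uniformlyRecurrent-embed ur im (isFactor-Δ a w fac)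
  ... | p , Pp , p-fac , ys , zs , p≡ with isFactor-S-lift p-fac
  ... | b , W , W-fac , ΔW≡p with Δ-infix b W ys (Δ (a ∷ w)) zs (trans ΔW≡p p≡)
  ... | c , V , V-in-W , ΔV =
    b , W , c xor a , W-fac , lifts b W (subst P (sym ΔW≡p) Pp) ,
    subst (λ t → Infix t (b ∷ W)) (Δ-injective a w c V (sym ΔV)) V-in-W

module _ {u : InfWord} (ur : UniformlyRecurrent (S u))
  (imE : InfinitelyManyFactors (λ w → IsRPalindrome w × CenteredAtLetter true w) (S u))
  (imR : InfinitelyManyFactors (λ w → IsRPalindrome w × ¬ CenteredAtLetter true w) (S u)) where

  cover-by-E-palindrome : ∀ a w → IsFactor (a ∷ w) u →
    ∃[ b ] ∃[ W ] ∃[ d ] (IsFactor (b ∷ W) u × Symmetric true (b ∷ W) × Infix (d ⊕ (a ∷ w)) (b ∷ W))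
  cover-by-E-palindrome = symmetricCover {c = true} ur imE (λ a w → uncurry (lift-centredAt1 a w))

  cover-by-R-palindrome : ∀ a w → IsFactor (a ∷ w) u →
    ∃[ b ] ∃[ W ] ∃[ d ] (IsFactor (b ∷ W) u × Symmetric false (b ∷ W) × Infix (d ⊕ (a ∷ w)) (b ∷ W))
  cover-by-R-palindrome = symmetricCover {c = false} ur imR (λ a w → uncurry (lift-notCentredAt1 a w))

  complement-closed : ∀ w → IsFactor w u → IsFactor (true ⊕ w) u
  complement-closed []      _   = 0 , refl
  complement-closed (a ∷ w) fac with cover-by-E-palindrome a w fac
  ... | b , W , d , W-fac , W-sym , w-in-W with cover-by-R-palindrome b W W-fac
  ... | _ , _ , d′ , W′-fac , W′-sym , W-in-W′ =
    complement-from-shifts (λ y → IsFactor y u) d (a ∷ w) (isFactor-infix W-fac w-in-W)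
                                     (isFactor-infix W-complement (infix-map (true xor_) w-in-W))
    where
    -- W = E W, so the mirror image of the occurrence d′ ⊕ W in W′ is the other shift of W.
    mirror : false ⊕ reverse (d′ ⊕ (b ∷ W)) ≡ true ⊕ d′ ⊕ (b ∷ W)
    mirror = begin
      false ⊕ reverse (d′ ⊕ (b ∷ W)) ≡⟨ ⊕-false _ ⟩
      reverse (d′ ⊕ (b ∷ W))         ≡⟨ reverse-map (d′ xor_) (b ∷ W) ⟨
      d′ ⊕ reverse (b ∷ W)           ≡⟨ cong (d′ ⊕_) W-sym ⟩
      d′ ⊕ true ⊕ (b ∷ W)            ≡⟨ ⊕-comm d′ true (b ∷ W) ⟩
      true ⊕ d′ ⊕ (b ∷ W)            ∎
    W-complement : IsFactor (true ⊕ (b ∷ W)) u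
    W-complement = complement-from-shifts (λ y → IsFactor y u) d′ (b ∷ W) (isFactor-infix W′-fac W-in-W′)
      (subst (λ y → IsFactor y u) mirror (symmetric-infix {c = false} W′-fac W′-sym W-in-W′))

  isFactor-unshift : ∀ d x → IsFactor (d ⊕ x) u → IsFactor x u
  isFactor-unshift false x fac = subst (λ y → IsFactor y u) (⊕-false x) fac
  isFactor-unshift true  x fac = subst (λ y → IsFactor y u) (⊕-involutive true x) (complement-closed _ fac)

  reverse-closed : ∀ w → IsFactor w u → IsFactor (reverse w) u
  reverse-closed []      _   = 0 , refl
  reverse-closed (a ∷ w) fac with cover-by-R-palindrome a w fac
  ... | _ , _ , d , W-fac , W-sym , w-in-W =
    isFactor-unshift d (reverse (a ∷ w)) (subst (λ y → IsFactor y u) mirror (symmetric-infix {c = false} W-fac W-sym w-in-W))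
    where
    mirror : false ⊕ reverse (d ⊕ (a ∷ w)) ≡ d ⊕ reverse (a ∷ w)
    mirror = trans (⊕-false _) (sym (reverse-map (d xor_) (a ∷ w)))

mainTheorem15 : (u : InfWord) → UniformlyRecurrent (S u)
    → InfinitelyManyFactors (λ w → IsRPalindrome w × CenteredAtLetter true w) (S u)
    → InfinitelyManyFactors (λ w → IsRPalindrome w × ¬ CenteredAtLetter true w) (S u)
    → ClosedUnder id u × ClosedUnder R u × ClosedUnder E u × ClosedUnder RE u
mainTheorem15 u ur imE imR = (λ _ fac → fac) , reverse-closed ur imE imR , E-closed , RE-closed
  where
  E-closed : ClosedUnder E u
  E-closed w fac = subst (λ y → IsFactor y u) (reverse-map (true xor_) w)
    (complement-closed ur imE imR (reverse w) (reverse-closed ur imE imR w fac))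
  RE-closed : ClosedUnder RE u
  RE-closed w fac = subst (λ y → IsFactor y u) (sym (reverse-involutive (map not w)))
    (complement-closed ur imE imR w fac)
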